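{- For every countable ordinal $\alpha\ge1$, there are families $\mathcal{H}\subseteq\mathcal{P}\mathbb{N}$ which are Wadge complete for $\mathbf{D}_\alpha(\mathcal{P}\mathbb{N})$ but not one-to-one Wadge complete for $\mathbf{D}_\alpha(\mathcal{P}\mathbb{N})$.
   Context: $\mathcal{P}\mathbb{N}$: powerset of $\mathbb{N}$ ordered by $\subseteq$ with the Scott topology (basic opens $\{X:A\subseteq X\}$, $A$ finite). Ordinal parity: $\alpha=\lambda+n$ ($\lambda$ zero or limit, $n$ finite) has parity of $n$. $D_\alpha((A_\beta)_{\beta<\alpha})=\bigcup\{A_\beta\setminus\bigcup_{\gamma<\beta}A_\gamma:\beta<\alpha,\ \beta,\alpha\text{ of different parity}\}$; $\mathbf{D}_\alpha(\mathcal{P}\mathbb{N})$: such families with open $A_\beta$. $\mathcal{H}$ is (one-to-one) Wadge complete for $\mathbf{D}_\alpha(\mathcal{P}\mathbb{N})$ if $\mathcal{H}\in\mathbf{D}_\alpha(\mathcal{P}\mathbb{N})$ and every member equals $f^{ -1}(\mathcal{H})$ for some continuous (resp. one-to-one continuous) $f:\mathcal{P}\mathbb{N}\to\mathcal{P}\mathbb{N}$. -}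

module Defs where

open import Level using (Level; 0ℓ) renaming (suc to lsuc)
open import Data.Nat using (ℕ)
open import Data.Bool using (Bool; true; false; not; _≟_)
open import Data.List using (List)
open import Data.List.Relation.Unary.All using (All)
open import Data.Maybe using (Maybe; just; nothing)
open import Data.Product using (Σ; ∃; _×_; _,_)
open import Data.Sum using (_⊎_)
open import Relation.Nullary using (¬_)
open import Relation.Binary.PropositionalEquality using (_≡_)
open import Induction.WellFounded using (WellFounded)
open import Function.Bundles using (_⇔_)

PN : Set
PN = ℕ → Bool

_∈_ : ℕ → PN → Set
n ∈ X = X n ≡ true

_≐_ : PN → PN → Set
X ≐ Y = ∀ n → X n ≡ Y n

_⊆fin_ : List ℕ → PN → Set
F ⊆fin X = All (_∈ X) F

Family : Set₁
Family = PN → Set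

-- Scott-open families: unions of basic opens {X : F ⊆ X}, F finite
IsOpen : Family → Set
IsOpen U = ∀ X → U X → Σ (List ℕ) λ F → F ⊆fin X × (∀ Y → F ⊆fin Y → U Y)

-- Scott-continuous maps PN → PN: preimages of subbasic opens {Y : n ∈ Y}
-- are open (equivalently, preimages of all Scott-open sets are open)
Continuous : (PN → PN) → Set
Continuous f = ∀ X n → n ∈ f X →
  Σ (List ℕ) λ F → F ⊆fin X × (∀ Y → F ⊆fin Y → n ∈ f Y)

OneToOne : (PN → PN) → Set
OneToOne f = ∀ X Y → f X ≐ f Y → X ≐ Y

-- Countable ordinals α ≥ 1, presented as countable (injection into ℕ),
-- nonempty, strict well-orders; the carrier I is the set {β : β < α}.

record CountableOrdinal : Set₁ where
  field
    I        : Set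
    _<_      : I → I → Set
    <-trans  : ∀ {x y z} → x < y → y < z → x < z
    <-irrefl : ∀ {x} → ¬ (x < x)
    <-total  : ∀ x y → x < y ⊎ x ≡ y ⊎ y < x
    <-wf     : WellFounded _<_
    code     : I → ℕ
    code-inj : ∀ x y → code x ≡ code y → x ≡ y
    nonempty : I

module _ (W : CountableOrdinal) where
  open CountableOrdinal W

  -- the ordinals ≤ α : elements of I (the β < α) together with α itself (nothing)
  _<⁺_ : Maybe I → Maybe I → Set
  just x  <⁺ just y  = x < y
  just x  <⁺ nothing = Data.Unit.⊤ where import Data.Unit
  nothing <⁺ _       = Data.Empty.⊥ where import Data.Empty

  -- Parity: Par x false  means x = λ + n with n even, Par x true  with n odd.
  data Par : Maybe I → Bool → Set where
    -- x is zero or a limit: no immediate predecessor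
    par-lim : ∀ x → (∀ y → y <⁺ x → Σ (Maybe I) λ z → y <⁺ z × z <⁺ x) → Par x false
    par-suc : ∀ x y b → y <⁺ x → (∀ z → y <⁺ z → ¬ (z <⁺ x)) → Par y b → Par x (not b)

  DiffParity : I → Set
  DiffParity β = Σ Bool λ b → Par (just β) b × Par nothing (not b)

  Dα : (I → Family) → Family
  Dα A X = Σ I λ β → A β X × (∀ γ → γ < β → ¬ A γ X) × DiffParity β

  InDα : Family → Set₁
  InDα H = Σ (I → Family) λ A → (∀ β → IsOpen (A β)) × (∀ X → H X ⇔ Dα A X)

  WadgeComplete : Family → Set₁
  WadgeComplete H = InDα H ×
    (∀ G → InDα G → Σ (PN → PN) λ f → Continuous f × (∀ X → G X ⇔ H (f X)))

  OneToOneWadgeComplete : Family → Set₁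
  OneToOneWadgeComplete H = InDα H ×
    (∀ G → InDα G → Σ (PN → PN) λ f → Continuous f × OneToOne f × (∀ X → G X ⇔ H (f X)))

module Submission where

-- Let code : {β < α} → ℕ be the injective
-- coding of α and put  B_β = {Y : code β ∈ Y} ∪ {Y : Y contains a non-code},
-- H = D_α((B_β)_β).  Completeness: D_α((A_β)_β) reduces to H by the
-- continuous map X ↦ {code β : X ∈ A_β}, whose images lie in B_β iff X ∈ A_β.
-- No one-to-one reduction: let f reduce G₀ = D_α((A₀_β)_β), where
-- A₀_β = {X : suc (code β) ∈ X}, to H.  By induction on β, f X ∉ B_β whenever
-- X misses A₀_γ for all γ ≤ β: if β is the last ordinal below α it differs in
-- parity from α, so f X ∈ H would force X ∈ G₀; otherwise β has an immediate
-- successor σ < α, and X ∪ {suc (code σ)} enters (A₀_γ) at σ while its image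
-- enters (B_γ) at β, impossible as exactly one of β, σ differs in parity from
-- α.  So f maps ∅ and {0} both to ∅.

open import Defs
open import Level using (Level; 0ℓ)
open import Axiom.ExcludedMiddle using (ExcludedMiddle)
open import Data.Nat using (ℕ; zero; suc; _≟_)
open import Data.Nat.Properties using (suc-injective)
open import Data.Bool using (Bool; true; false; not)
open import Data.Bool.Properties using (not-¬; ¬-not) renaming (_≟_ to _≟ᵇ_)
open import Data.Maybe using (Maybe; just; nothing)
open import Data.Product using (Σ; _×_; _,_; proj₁)
open import Data.Sum using (_⊎_; inj₁; inj₂)
open import Data.Empty using (⊥; ⊥-elim)
open import Data.Unit using (tt)
open import Data.List using ([]; _∷_)
open import Data.List.Relation.Unary.All using ([]; _∷_)
import Data.List.Relation.Unary.All as All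
open import Relation.Nullary using (¬_; yes; no)
open import Relation.Binary.PropositionalEquality using (_≡_; refl; cong; subst)
open import Induction.WellFounded using (Acc; acc)
open import Function.Bundles using (_⇔_; mk⇔; Equivalence)
open import Function.Construct.Identity using (⇔-id)
open import Function.Construct.Symmetry using (⇔-sym)
open import Function.Construct.Composition using (_⇔-∘_)

_⊆_ : PN → PN → Set
X ⊆ Y = ∀ n → n ∈ X → n ∈ Y

-- Scott-continuous maps are monotone: a finite witness for n ∈ f X inside X
-- is also inside any superset of X.
continuous-monotone : ∀ {f} → Continuous f → ∀ X Y → X ⊆ Y → f X ⊆ f Y
continuous-monotone cont X Y X⊆Y n n∈fX with cont X n n∈fX
... | F , F⊆X , witness = witness Y (All.map (X⊆Y _) F⊆X)

point-open : ∀ n → IsOpen (λ X → n ∈ X)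
point-open n X n∈X = n ∷ [] , n∈X ∷ [] , λ { Y (n∈Y ∷ []) → n∈Y }

∪-open : ∀ {U V} → IsOpen U → IsOpen V → IsOpen (λ X → U X ⊎ V X)
∪-open U-open V-open X (inj₁ u) with U-open X u
... | F , F⊆X , F⊆⇒U = F , F⊆X , λ Y F⊆Y → inj₁ (F⊆⇒U Y F⊆Y)
∪-open U-open V-open X (inj₂ v) with V-open X v
... | F , F⊆X , F⊆⇒V = F , F⊆X , λ Y F⊆Y → inj₂ (F⊆⇒V Y F⊆Y)

insert : ℕ → PN → PN
insert m X n with n ≟ m
... | yes _ = true
... | no _  = X n

insert-new : ∀ m X → m ∈ insert m X
insert-new m X with m ≟ m
... | yes _   = refl
... | no m≢m = ⊥-elim (m≢m refl)

insert-⊇ : ∀ m X → X ⊆ insert m X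
insert-⊇ m X n n∈X with n ≟ m
... | yes _ = refl
... | no _  = n∈X

insert-⊆ : ∀ m X n → n ∈ insert m X → n ∈ X ⊎ n ≡ m
insert-⊆ m X n n∈X' with n ≟ m
... | yes n≡m = inj₂ n≡m
... | no _    = inj₁ n∈X'

module _ (em : ExcludedMiddle 0ℓ) (W : CountableOrdinal) where
  open CountableOrdinal W

  _⊏_ : Maybe I → Maybe I → Set
  x ⊏ y = _<⁺_ W x y

  ⊏-acc-just : ∀ x → Acc _<_ x → Acc _⊏_ (just x)
  ⊏-acc-just x (acc rs) = acc λ { {just y} y<x → ⊏-acc-just y (rs y<x) }

  ⊏-wf : ∀ x → Acc _⊏_ x
  ⊏-wf (just x) = ⊏-acc-just x (<-wf x)
  ⊏-wf nothing  = acc λ { {just y} _ → ⊏-acc-just y (<-wf y) }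

  least : (P : Maybe I → Set) → ∀ x → P x →
          Σ (Maybe I) λ m → P m × (∀ z → P z → ¬ (z ⊏ m))
  least P x = go x (⊏-wf x)
    where
    go : ∀ x → Acc _⊏_ x → P x → Σ (Maybe I) λ m → P m × (∀ z → P z → ¬ (z ⊏ m))
    go x (acc rs) px with em {Σ (Maybe I) λ z → P z × z ⊏ x}
    ... | yes (z , pz , z⊏x) = go z (rs z⊏x) pz
    ... | no none            = x , px , λ z pz z⊏x → none (z , pz , z⊏x)

  Immediate : Maybe I → Maybe I → Set
  Immediate y x = y ⊏ x × (∀ z → y ⊏ z → ¬ (z ⊏ x))

  successor : ∀ β → Σ (Maybe I) (Immediate (just β))
  successor β = least (just β ⊏_) nothing tt

  _≤_ : I → I → Set
  γ ≤ β = γ < β ⊎ γ ≡ β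

  below-successor : ∀ {β x γ} → Immediate (just β) x → just γ ⊏ x → γ ≤ β
  below-successor {β} {_} {γ} (_ , gap) γ⊏x with <-total γ β
  ... | inj₁ γ<β        = inj₁ γ<β
  ... | inj₂ (inj₁ γ≡β) = inj₂ γ≡β
  ... | inj₂ (inj₂ β<γ) = ⊥-elim (gap (just γ) β<γ γ⊏x)

  ≤-<-trans : ∀ {γ β σ} → γ ≤ β → β < σ → γ < σ
  ≤-<-trans (inj₁ γ<β) β<σ = <-trans γ<β β<σ
  ≤-<-trans (inj₂ refl) β<σ = β<σ

  parity : ∀ x → Σ Bool (Par W x)
  parity x = go x (⊏-wf x)
    where
    go : ∀ x → Acc _⊏_ x → Σ Bool (Par W x)
    go x (acc rs) with em {Σ (Maybe I) λ y → Immediate y x}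
    ... | yes (y , y⊏x , gap) with go y (rs y⊏x)
    ...   | b , py = not b , par-suc x y b y⊏x gap py
    go x (acc rs) | no noPred = false , par-lim x between
      where
      between : ∀ y → y ⊏ x → Σ (Maybe I) λ z → y ⊏ z × z ⊏ x
      between y y⊏x with em {Σ (Maybe I) λ z → y ⊏ z × z ⊏ x}
      ... | yes z = z
      ... | no noZ = ⊥-elim (noPred (y , y⊏x , λ z y⊏z z⊏x → noZ (z , y⊏z , z⊏x)))

  immediate-unique : ∀ {x y y'} → Immediate y x → Immediate y' x → y ≡ y'
  immediate-unique {_} {just a} {just a'} (a⊏x , gap) (a'⊏x , gap') with <-total a a'
  ... | inj₁ a<a'        = ⊥-elim (gap (just a') a<a' a'⊏x)
  ... | inj₂ (inj₁ refl) = refl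
  ... | inj₂ (inj₂ a'<a) = ⊥-elim (gap' (just a) a'<a a⊏x)

  parity-unique : ∀ {x b c} → Par W x b → Par W x c → b ≡ c
  parity-unique {x} = go x (⊏-wf x)
    where
    go : ∀ x → Acc _⊏_ x → ∀ {b c} → Par W x b → Par W x c → b ≡ c
    go x _ (par-lim _ _) (par-lim _ _) = refl
    go x _ (par-lim _ between) (par-suc _ y _ y⊏x gap _) with between y y⊏x
    ... | z , y⊏z , z⊏x = ⊥-elim (gap z y⊏z z⊏x)
    go x _ (par-suc _ y _ y⊏x gap _) (par-lim _ between) with between y y⊏x
    ... | z , y⊏z , z⊏x = ⊥-elim (gap z y⊏z z⊏x)
    go x (acc rs) (par-suc _ y _ y⊏x gap py) (par-suc _ y' _ y'⊏x gap' py')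
      with immediate-unique {x} {y} {y'} (y⊏x , gap) (y'⊏x , gap')
    ... | refl = cong not (go y (rs y⊏x) py py')

  last-diffParity : ∀ {β} → Immediate (just β) nothing → DiffParity W β
  last-diffParity {β} (β⊏α , gap) with parity (just β)
  ... | b , pβ = b , pβ , par-suc nothing (just β) b β⊏α gap pβ

  diffParity-step : ∀ {β σ} → Immediate (just β) (just σ) →
                    (DiffParity W β ⊎ DiffParity W σ) × ¬ (DiffParity W β × DiffParity W σ)
  diffParity-step {β} {σ} (β<σ , gap) with parity (just β) | parity nothing
  ... | b , pβ | c , pα = one c pα , notBoth
    where
    pσ : Par W (just σ) (not b)
    pσ = par-suc (just σ) (just β) b β<σ gap pβ
    one : ∀ c → Par W nothing c → DiffParity W β ⊎ DiffParity W σ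
    one c pα with c ≟ᵇ not b
    ... | yes refl = inj₁ (b , pβ , pα)
    ... | no c≢¬b  = inj₂ (not b , pσ , subst (Par W nothing) (¬-not c≢¬b) pα)
    notBoth : ¬ (DiffParity W β × DiffParity W σ)
    notBoth ((b' , pβ' , pα') , (s , pσ' , pα''))
      with parity-unique pβ pβ' | parity-unique pσ pσ'
    ... | refl | refl = not-¬ refl (parity-unique pα' pα'')

  record FirstIn (A : I → Family) (X : PN) (β : I) : Set where
    constructor enters-at
    field
      entered : A β X
      earlier : ∀ γ → γ < β → ¬ A γ X

  first-unique : ∀ {A X β β'} → FirstIn A X β → FirstIn A X β' → β ≡ β'
  first-unique {β = β} {β'} (enters-at aβ minβ) (enters-at aβ' minβ') with <-total β β'
  ... | inj₁ β<β'        = ⊥-elim (minβ' β β<β' aβ)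
  ... | inj₂ (inj₁ β≡β') = β≡β'
  ... | inj₂ (inj₂ β'<β) = ⊥-elim (minβ β' β'<β aβ')

  Dα-at : ∀ {A X β} → FirstIn A X β → Dα W A X ⇔ DiffParity W β
  Dα-at {A} {X} {β} first@(enters-at aβ minβ) = mk⇔ to (λ dβ → β , aβ , minβ , dβ)
    where
    to : Dα W A X → DiffParity W β
    to (β' , aβ' , minβ' , dβ') with first-unique (enters-at aβ' minβ') first
    ... | refl = dβ'

  -- A reduction between D_α-families cannot send a set entering at σ to one
  -- entering at the immediate predecessor β of σ: exactly one of β, σ counts.
  consecutive-entries : ∀ {A A' X Y β σ} → (Dα W A X ⇔ Dα W A' Y) →
                        FirstIn A X σ → FirstIn A' Y β → Immediate (just β) (just σ) → ⊥
  consecutive-entries {A} {A'} X⇔Y firstX firstY imm with diffParity-step imm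
  ... | inj₁ dβ , notBoth =
    notBoth (dβ , Equivalence.to (Dα-at {A} firstX)
                    (Equivalence.from X⇔Y (Equivalence.from (Dα-at {A'} firstY) dβ)))
  ... | inj₂ dσ , notBoth =
    notBoth (Equivalence.to (Dα-at {A'} firstY)
               (Equivalence.to X⇔Y (Equivalence.from (Dα-at {A} firstX) dσ)) , dσ)

  Dα-cong : ∀ {A A' X Y} → (∀ β → A β X ⇔ A' β Y) → Dα W A X ⇔ Dα W A' Y
  Dα-cong {A} {A'} {X} {Y} A⇔A' =
    mk⇔ (transfer A A' X Y A⇔A') (transfer A' A Y X (λ β → ⇔-sym (A⇔A' β)))
    where
    transfer : ∀ C C' U V → (∀ β → C β U ⇔ C' β V) → Dα W C U → Dα W C' V
    transfer C C' U V C⇔C' (β , c , minβ , dβ) =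
      β , Equivalence.to (C⇔C' β) c ,
      (λ γ γ<β c' → minβ γ γ<β (Equivalence.from (C⇔C' γ) c')) , dβ

  IsCode : ℕ → Set
  IsCode n = Σ I λ γ → code γ ≡ n

  N : Family
  N Y = Σ ℕ λ n → n ∈ Y × ¬ IsCode n

  B : I → Family
  B β Y = code β ∈ Y ⊎ N Y

  B-monotone : ∀ β {Y Z} → Y ⊆ Z → B β Y → B β Z
  B-monotone β Y⊆Z (inj₁ c∈Y)              = inj₁ (Y⊆Z (code β) c∈Y)
  B-monotone β Y⊆Z (inj₂ (n , n∈Y , noCode)) = inj₂ (n , Y⊆Z n n∈Y , noCode)

  H : Family
  H = Dα W B

  B-open : ∀ β → IsOpen (B β)
  B-open β = ∪-open (point-open (code β)) N-open
    where
    N-open : IsOpen N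
    N-open X (n , n∈X , noCode) with point-open n X n∈X
    ... | F , F⊆X , F⊆⇒n = F , F⊆X , λ Y F⊆Y → n , F⊆⇒n Y F⊆Y , noCode

  H-in-Dα : InDα W H
  H-in-Dα = B , B-open , λ X → ⇔-id _

  indicator : (ℕ → Set) → PN
  indicator P n with em {P n}
  ... | yes _ = true
  ... | no _  = false

  indicator-intro : ∀ P n → P n → n ∈ indicator P
  indicator-intro P n p with em {P n}
  ... | yes _  = refl
  ... | no ¬p = ⊥-elim (¬p p)

  indicator-elim : ∀ P n → n ∈ indicator P → P n
  indicator-elim P n n∈ with em {P n}
  ... | yes p = p

  H-complete : ∀ G → InDα W G → Σ (PN → PN) λ f → Continuous f × (∀ X → G X ⇔ H (f X))
  H-complete G (A , A-open , G⇔) =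
    f , f-continuous , λ X → Dα-cong {A} {B} (A⇔B X) ⇔-∘ G⇔ X
    where
    Coded : PN → ℕ → Set
    Coded X n = Σ I λ β → code β ≡ n × A β X

    f : PN → PN
    f X = indicator (Coded X)

    f-continuous : Continuous f
    f-continuous X n n∈fX with indicator-elim (Coded X) n n∈fX
    ... | β , refl , aβ with A-open β X aβ
    ... | F , F⊆X , F⊆⇒A =
      F , F⊆X , λ Y F⊆Y → indicator-intro (Coded Y) n (β , refl , F⊆⇒A Y F⊆Y)

    A⇔B : ∀ X β → A β X ⇔ B β (f X)
    A⇔B X β = mk⇔ (λ aβ → inj₁ (indicator-intro (Coded X) (code β) (β , refl , aβ))) from
      where
      from : B β (f X) → A β X
      from (inj₁ c∈fX) with indicator-elim (Coded X) (code β) c∈fX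
      ... | β' , c≡c , aβ' with code-inj β' β c≡c
      ... | refl = aβ'
      from (inj₂ (n , n∈fX , noCode)) with indicator-elim (Coded X) n n∈fX
      ... | β' , c≡n , _ = ⊥-elim (noCode (β' , c≡n))

  A₀ : I → Family
  A₀ β X = suc (code β) ∈ X

  G₀ : Family
  G₀ = Dα W A₀

  G₀-in-Dα : InDα W G₀
  G₀-in-Dα = A₀ , (λ β → point-open (suc (code β))) , λ X → ⇔-id _

  Avoids : PN → I → Set
  Avoids X β = ∀ γ → γ ≤ β → ¬ A₀ γ X

  avoids-below : ∀ {X β γ} → Avoids X β → γ < β → Avoids X γ
  avoids-below av γ<β δ δ≤γ = av δ (inj₁ (≤-<-trans δ≤γ γ<β))

  avoids-insert : ∀ {X β σ} → Avoids X β → β < σ → Avoids (insert (suc (code σ)) X) β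
  avoids-insert {X} {β} {σ} av β<σ γ γ≤β a with insert-⊆ (suc (code σ)) X _ a
  ... | inj₁ aX = av γ γ≤β aX
  ... | inj₂ e with code-inj γ σ (suc-injective e)
  ... | refl = <-irrefl (≤-<-trans γ≤β β<σ)

  module Reduction (f : PN → PN) (f-continuous : Continuous f)
                   (reduces : ∀ X → G₀ X ⇔ H (f X)) where

    avoids⇒∉B : ∀ β X → Avoids X β → ¬ B β (f X)
    avoids⇒∉B β = go β (<-wf β)
      where
      go : ∀ β → Acc _<_ β → ∀ X → Avoids X β → ¬ B β (f X)
      go β (acc rs) X av bβ with successor β
      ... | nothing , imm = top
        where
        -- β is the last ordinal below α, so f X ∈ H and hence X ∈ G₀.
        firstB : FirstIn B (f X) β
        firstB = enters-at bβ λ γ γ<β → go γ (rs γ<β) X (avoids-below {X} av γ<β)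
        top : ⊥
        top with Equivalence.from (reduces X)
                   (Equivalence.from (Dα-at firstB) (last-diffParity imm))
        ... | γ , aγ , _ = av γ (below-successor imm tt) aγ
      ... | just σ , imm = consecutive-entries (reduces X'') firstA firstB imm
        where
        -- X'' = X ∪ {suc (code σ)} enters (A₀_γ) at σ and (B_γ) at β.
        X'' : PN
        X'' = insert (suc (code σ)) X
        av'' : Avoids X'' β
        av'' = avoids-insert {X} av (proj₁ imm)
        fX⊆fX'' : f X ⊆ f X''
        fX⊆fX'' = continuous-monotone f-continuous X X'' (insert-⊇ (suc (code σ)) X)
        firstB : FirstIn B (f X'') β
        firstB = enters-at (B-monotone β fX⊆fX'' bβ)
                           λ γ γ<β → go γ (rs γ<β) X'' (avoids-below {X''} av'' γ<β)
        firstA : FirstIn A₀ X'' σ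
        firstA = enters-at (insert-new (suc (code σ)) X)
                           λ γ γ<σ → av'' γ (below-successor imm γ<σ)

    avoids⇒empty : ∀ X → (∀ γ → ¬ A₀ γ X) → ∀ n → f X n ≡ false
    avoids⇒empty X miss n with f X n in n∈fX
    ... | false = refl
    ... | true with em {IsCode n}
    ...   | yes (γ , refl) = ⊥-elim (avoids⇒∉B γ X (λ δ _ → miss δ) (inj₁ n∈fX))
    ...   | no noCode      =
      ⊥-elim (avoids⇒∉B nonempty X (λ δ _ → miss δ) (inj₂ (n , n∈fX , noCode)))

  -- empty and {0} both miss every A₀_γ, so no reduction of G₀ to H is one-to-one.
  H-not-injectively-complete : ¬ OneToOneWadgeComplete W H
  H-not-injectively-complete (_ , reduce) with reduce G₀ G₀-in-Dα
  ... | f , f-continuous , injective , reduces =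
    false≢true (injective empty zero-only same-image 0)
    where
    open Reduction f f-continuous reduces
    empty zero-only : PN
    empty _ = false
    zero-only zero    = true
    zero-only (suc _) = false
    same-image : f empty ≐ f zero-only
    same-image n rewrite avoids⇒empty empty (λ _ ()) n | avoids⇒empty zero-only (λ _ ()) n = refl
    false≢true : false ≡ true → ⊥
    false≢true ()

corollary4p16 : (∀ {ℓ : Level} → ExcludedMiddle ℓ) →
    (α : CountableOrdinal) →
      Σ Family λ H → WadgeComplete α H × ¬ OneToOneWadgeComplete α H
corollary4p16 em α =
  H em α , (H-in-Dα em α , H-complete em α) , H-not-injectively-complete em α
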